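{- Let $R$ be a commutative ring with unity and let $l\geq 0$ be an integer. Let $\mathcal{Q}_1,\dots,\mathcal{Q}_k$ be nonzero ideals of $R$ such that $\mathrm{rad}(\mathcal{Q}_i)=\mathcal{M}_i$ for each $i$, where $\mathcal{M}_1,\dots,\mathcal{M}_k$ are pairwise distinct maximal ideals of $R$, and let $\mathcal{I}=\mathcal{Q}_1\mathcal{Q}_2\cdots\mathcal{Q}_k\neq 0$. Then the chinese remainder reduction map $$\mathbb{PF}^{l+1}_{\mathcal{I}}\longrightarrow \mathbb{PF}^{l+1}_{\mathcal{Q}_1}\times\mathbb{PF}^{l+1}_{\mathcal{Q}_2}\times\cdots\times\mathbb{PF}^{l+1}_{\mathcal{Q}_k},$$ sending the class of a unital tuple $(a_0,\dots,a_{l+1})$ modulo $\mathcal{I}$ to the tuple of its classes modulo each $\mathcal{Q}_i$, is surjective.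
   Context: A finite tuple $(a_0,\dots,a_n)$ of elements of $R$ is called unital if the ideal generated by $a_0,\dots,a_n$ is $R$. Let $\mathcal{INTRAD}(R)^*$ be the set of nonzero ideals of $R$ which are an (arbitrary) intersection of ideals whose radicals are pairwise distinct maximal ideals. For $0\neq\mathcal{I}\in\mathcal{INTRAD}(R)^*$ and $n\geq 0$, define on unital tuples in $R^{n+1}$ the relation $(a_0,\dots,a_n)\sim(b_0,\dots,b_n)$ iff $a_ib_j-a_jb_i\in\mathcal{I}$ for all $0\le i<j\le n$; this is an equivalence relation. The class of $(a_0,\dots,a_n)$ is written $[a_0:\dots:a_n]$ and the set of classes is the projective space $\mathbb{PF}^n_{\mathcal{I}}$. The ideals $\mathcal{Q}_i$ and $\mathcal{I}$ above lie in $\mathcal{INTRAD}(R)^*$; the reduction map is well defined since $\mathcal{I}\subseteq\mathcal{Q}_i$. -}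

module Defs where

open import Level using (Level; _⊔_)
open import Algebra.Bundles using (CommutativeRing)
open import Data.Nat using (ℕ; zero; suc)
open import Data.Fin using (Fin; zero; suc; _<_)
open import Data.Product using (Σ; ∃; _×_)
open import Data.Sum using (_⊎_)
open import Data.Unit.Polymorphic using (⊤)
open import Relation.Nullary using (¬_)

module RingDefs {c ℓ : Level} (R : CommutativeRing c ℓ) where
  open CommutativeRing R using (Carrier; _≈_; _+_; _*_; -_; 0#; 1#)

  Elt : Set c
  Elt = Carrier

  record Ideal : Set (Level.suc (c ⊔ ℓ)) where
    field
      _∈I    : Carrier → Set (c ⊔ ℓ)
      ∈-resp : ∀ {x y} → x ≈ y → x ∈I → y ∈I
      0∈     : 0# ∈I
      +∈     : ∀ {x y} → x ∈I → y ∈I → (x + y) ∈I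
      *∈     : ∀ r {x} → x ∈I → (r * x) ∈I
  open Ideal public

  _∈_ : Carrier → Ideal → Set (c ⊔ ℓ)
  x ∈ I = (I ∈I) x

  _⊆_ : Ideal → Ideal → Set (c ⊔ ℓ)
  I ⊆ J = ∀ {x} → x ∈ I → x ∈ J

  _≐_ : Ideal → Ideal → Set (c ⊔ ℓ)
  I ≐ J = (I ⊆ J) × (J ⊆ I)

  NonZero : Ideal → Set (c ⊔ ℓ)
  NonZero I = Σ Carrier λ x → x ∈ I × ¬ (x ≈ 0#)

  unitIdeal : Ideal
  unitIdeal = record
    { _∈I = λ _ → ⊤ ; ∈-resp = λ _ _ → _ ; 0∈ = _ ; +∈ = λ _ _ → _ ; *∈ = λ _ _ → _ }

  data ProdPred (I J : Ideal) : Carrier → Set (c ⊔ ℓ) where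
    gen  : ∀ {x y} → x ∈ I → y ∈ J → ProdPred I J (x * y)
    resp : ∀ {x y} → x ≈ y → ProdPred I J x → ProdPred I J y
    zer  : ProdPred I J 0#
    add  : ∀ {x y} → ProdPred I J x → ProdPred I J y → ProdPred I J (x + y)
    mul  : ∀ r {x} → ProdPred I J x → ProdPred I J (r * x)

  _·_ : Ideal → Ideal → Ideal
  I · J = record
    { _∈I = ProdPred I J ; ∈-resp = resp ; 0∈ = zer ; +∈ = add ; *∈ = mul }

  prodIdeals : (k : ℕ) → (Fin k → Ideal) → Ideal
  prodIdeals zero    Q = unitIdeal
  prodIdeals (suc k) Q = Q zero · prodIdeals k (λ i → Q (suc i))

  pow : Carrier → ℕ → Carrier
  pow x zero    = 1#
  pow x (suc n) = x * pow x n

  _∈rad_ : Carrier → Ideal → Set (c ⊔ ℓ)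
  x ∈rad Q = ∃ λ n → pow x n ∈ Q

  RadEq : Ideal → Ideal → Set (c ⊔ ℓ)
  RadEq Q M = (∀ {x} → x ∈rad Q → x ∈ M) × (∀ {x} → x ∈ M → x ∈rad Q)

  IsMaximal : Ideal → Set (Level.suc (c ⊔ ℓ))
  IsMaximal M = ¬ (1# ∈ M) × (∀ (J : Ideal) → M ⊆ J → (J ⊆ M) ⊎ (1# ∈ J))

  Σᶠ : (n : ℕ) → (Fin n → Carrier) → Carrier
  Σᶠ zero    f = 0#
  Σᶠ (suc n) f = f zero + Σᶠ n (λ i → f (suc i))

  -- (a₀,…,a_{n}) is unital: the ideal it generates is R, i.e. Σ cᵢ aᵢ = 1 for some cᵢ
  Unital : (n : ℕ) → (Fin n → Carrier) → Set (c ⊔ ℓ)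
  Unital n a = Σ (Fin n → Carrier) λ cs → Σᶠ n (λ i → cs i * a i) ≈ 1#

  -- the relation defining ℙF_I: aᵢbⱼ − aⱼbᵢ ∈ I for all i < j
  ProjEquiv : (I : Ideal) (n : ℕ) → (Fin n → Carrier) → (Fin n → Carrier) → Set (c ⊔ ℓ)
  ProjEquiv I n a b = ∀ (i j : Fin n) → i < j → (a i * b j + - (a j * b i)) ∈ I

-- Each Qᵢ is Mᵢ-primary, so modulo Qᵢ every element outside Mᵢ is invertible. Hence a unital
-- tuple bᵢ has a multiple βᵢ = sᵢbᵢ with βᵢ₀ + Σⱼ tᵢⱼβᵢⱼ ≡ 1 (mod Qᵢ): if bᵢ₀ ∉ Mᵢ invert it,
-- and if bᵢ₀ ∈ Mᵢ the remainder of a unit relation c·bᵢ = 1 is invertible mod Qᵢ. Distinct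
-- maximal ideals are comaximal, hence so are the Qᵢ, and the Chinese remainder theorem gives
-- aⱼ ≡ βᵢⱼ and xⱼ ≡ tᵢⱼ modulo every Qᵢ for j ≥ 1. Setting a₀ = 1 − Σⱼ xⱼaⱼ makes a unital on
-- the nose and forces a₀ ≡ βᵢ₀ modulo every Qᵢ; a tuple congruent to a multiple of bᵢ is
-- equivalent to bᵢ.

module Submission where

open import Defs
open import Level using (Level; _⊔_)
open import Algebra.Bundles using (CommutativeRing)
open import Data.Nat using (ℕ; zero; suc)
open import Data.Fin using (Fin; zero; suc; punchIn)
open import Data.Fin.Properties using (punchInᵢ≢i; _≟_)
open import Data.Product using (Σ; _×_; _,_; proj₁; proj₂)
open import Data.Sum using (_⊎_; inj₁; inj₂; [_,_])
open import Data.Empty using (⊥-elim)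
open import Function using (_∘_)
open import Relation.Binary.PropositionalEquality as ≡ using (_≡_; _≢_)
open import Relation.Nullary using (¬_; yes; no)

module _ {c ℓ : Level} (R : CommutativeRing c ℓ) where
  open CommutativeRing R hiding (zero)
  open RingDefs R
  open import Algebra.Properties.Ring ring using (-1*x≈-x; [y-z]x≈yx-zx)
  open import Algebra.Properties.AbelianGroup +-abelianGroup
    using ( ⁻¹-anti-homo‿-; ⁻¹-∙-comm; xyx⁻¹≈y; x≈y⇒x∙y⁻¹≈ε
          ; //-rightDividesˡ; //-rightDividesʳ )
  open import Algebra.Properties.CommutativeMonoid.Sum +-commutativeMonoid
    using (sum; sum-remove)
  open import Algebra.Solver.Ring.NaturalCoefficients.Default commutativeSemiring

  infix 4 _≡_mod_
  _≡_mod_ : Elt → Elt → Ideal → Set (c ⊔ ℓ)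
  x ≡ y mod Q = (x + - y) ∈ Q

  ≈⇒≡mod : ∀ Q {x y} → x ≈ y → x ≡ y mod Q
  ≈⇒≡mod Q x≈y = ∈-resp Q (sym (x≈y⇒x∙y⁻¹≈ε x≈y)) (0∈ Q)

  ≈+∈⇒≡mod : ∀ Q {x y q} → x ≈ y + q → q ∈ Q → x ≡ y mod Q
  ≈+∈⇒≡mod Q {x} {y} {q} x≈y+q q∈Q =
    ∈-resp Q (sym (trans (+-congʳ x≈y+q) (xyx⁻¹≈y y q))) q∈Q

  quotientRing : Ideal → CommutativeRing c (c ⊔ ℓ)
  quotientRing Q = record
    { Carrier = Elt ; _≈_ = λ x y → x ≡ y mod Q
    ; _+_ = _+_ ; _*_ = _*_ ; -_ = -_ ; 0# = 0# ; 1# = 1#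
    ; isCommutativeRing = record
      { isRing = record
        { +-isAbelianGroup = record
          { isGroup = record
            { isMonoid = record
              { isSemigroup = record
                { isMagma = record
                  { isEquivalence = record
                    { refl = lift refl ; sym = ≡mod-sym ; trans = ≡mod-trans }
                  ; ∙-cong = +-cong-mod }
                ; assoc = λ x y z → lift (+-assoc x y z) }
              ; identity = (λ x → lift (+-identityˡ x)) , (λ x → lift (+-identityʳ x)) }
            ; inverse = (λ x → lift (-‿inverseˡ x)) , (λ x → lift (-‿inverseʳ x))
            ; ⁻¹-cong = -‿cong-mod }
          ; comm = λ x y → lift (+-comm x y) }
        ; *-cong = *-cong-mod
        ; *-assoc = λ x y z → lift (*-assoc x y z)
        ; *-identity = (λ x → lift (*-identityˡ x)) , (λ x → lift (*-identityʳ x))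
        ; distrib = (λ x y z → lift (distribˡ x y z)) , (λ x y z → lift (distribʳ x y z)) }
      ; *-comm = λ x y → lift (*-comm x y) } }
    where
    open import Relation.Binary.Reasoning.Setoid setoid

    lift : ∀ {x y} → x ≈ y → x ≡ y mod Q
    lift = ≈⇒≡mod Q

    -‿∈ : ∀ {x} → x ∈ Q → (- x) ∈ Q
    -‿∈ {x} x∈Q = ∈-resp Q (-1*x≈-x x) (*∈ Q (- 1#) x∈Q)

    ≡mod-sym : ∀ {x y} → x ≡ y mod Q → y ≡ x mod Q
    ≡mod-sym {x} {y} x≡y = ∈-resp Q (⁻¹-anti-homo‿- x y) (-‿∈ x≡y)

    ≡mod-trans : ∀ {x y z} → x ≡ y mod Q → y ≡ z mod Q → x ≡ z mod Q
    ≡mod-trans {x} {y} {z} x≡y y≡z = ∈-resp Q telescope (+∈ Q x≡y y≡z)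
      where
      telescope : (x + - y) + (y + - z) ≈ x + - z
      telescope = begin
        (x + - y) + (y + - z)  ≈⟨ solve 4 (λ x y -y -z → (x :+ -y) :+ (y :+ -z) := (x :+ -z) :+ (y :+ -y))
                                          refl x y (- y) (- z) ⟩
        (x + - z) + (y + - y)  ≈⟨ +-congˡ (-‿inverseʳ y) ⟩
        (x + - z) + 0#         ≈⟨ +-identityʳ _ ⟩
        x + - z                ∎

    +-cong-mod : ∀ {x y u v} → x ≡ y mod Q → u ≡ v mod Q → x + u ≡ y + v mod Q
    +-cong-mod {x} {y} {u} {v} x≡y u≡v = ∈-resp Q regroup (+∈ Q x≡y u≡v)
      where
      regroup : (x + - y) + (u + - v) ≈ (x + u) + - (y + v)
      regroup = begin
        (x + - y) + (u + - v)  ≈⟨ solve 4 (λ x -y u -v → (x :+ -y) :+ (u :+ -v) := (x :+ u) :+ (-y :+ -v))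
                                          refl x (- y) u (- v) ⟩
        (x + u) + (- y + - v)  ≈⟨ +-congˡ (⁻¹-∙-comm y v) ⟩
        (x + u) + - (y + v)    ∎

    *-congʳ-mod : ∀ {x y} u → x ≡ y mod Q → x * u ≡ y * u mod Q
    *-congʳ-mod {x} {y} u x≡y = ∈-resp Q (trans (*-comm u _) ([y-z]x≈yx-zx u x y)) (*∈ Q u x≡y)

    *-cong-mod : ∀ {x y u v} → x ≡ y mod Q → u ≡ v mod Q → x * u ≡ y * v mod Q
    *-cong-mod {x} {y} {u} {v} x≡y u≡v =
      ≡mod-trans (*-congʳ-mod u x≡y) (≡mod-trans (lift (*-comm y u))
        (≡mod-trans (*-congʳ-mod y u≡v) (lift (*-comm v y))))

    -‿cong-mod : ∀ {x y} → x ≡ y mod Q → - x ≡ - y mod Q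
    -‿cong-mod {x} {y} x≡y = ∈-resp Q (sym (⁻¹-∙-comm x (- y))) (-‿∈ x≡y)

  module Mod (Q : Ideal) = CommutativeRing (quotientRing Q)

  Σᶠ-∈ : ∀ (I : Ideal) n {f : Fin n → Elt} → (∀ j → f j ∈ I) → Σᶠ n f ∈ I
  Σᶠ-∈ I zero    f∈I = 0∈ I
  Σᶠ-∈ I (suc n) f∈I = +∈ I (f∈I zero) (Σᶠ-∈ I n (f∈I ∘ suc))

  Σᶠ-cong-mod : ∀ Q n {f g : Fin n → Elt} → (∀ j → f j ≡ g j mod Q) → Σᶠ n f ≡ Σᶠ n g mod Q
  Σᶠ-cong-mod Q zero    f≡g = Mod.refl Q
  Σᶠ-cong-mod Q (suc n) f≡g = Mod.+-cong Q (f≡g zero) (Σᶠ-cong-mod Q n (f≡g ∘ suc))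

  *-distribˡ-Σᶠ : ∀ n x (f : Fin n → Elt) → x * Σᶠ n f ≈ Σᶠ n (λ j → x * f j)
  *-distribˡ-Σᶠ zero    x f = zeroʳ x
  *-distribˡ-Σᶠ (suc n) x f = trans (distribˡ x _ _) (+-congˡ (*-distribˡ-Σᶠ n x (f ∘ suc)))

  Σᶠ≡sum : ∀ n (f : Fin n → Elt) → Σᶠ n f ≡ sum f
  Σᶠ≡sum zero    f = ≡.refl
  Σᶠ≡sum (suc n) f = ≡.cong (f zero +_) (Σᶠ≡sum n (f ∘ suc))

  Σᶠ-≡-single : ∀ Q {n} (f : Fin n → Elt) m → (∀ j → j ≢ m → f j ∈ Q) → Σᶠ n f ≡ f m mod Q
  Σᶠ-≡-single Q {suc n} f m others∈Q =
    ≈+∈⇒≡mod Q Σf≈fm+rest (Σᶠ-∈ Q n (λ j → others∈Q (punchIn m j) (punchInᵢ≢i m j)))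
    where
    Σf≈fm+rest : Σᶠ (suc n) f ≈ f m + Σᶠ n (f ∘ punchIn m)
    Σf≈fm+rest rewrite Σᶠ≡sum (suc n) f | Σᶠ≡sum n (f ∘ punchIn m) = sum-remove {i = m} f

  Πᶠ : (n : ℕ) → (Fin n → Elt) → Elt
  Πᶠ zero    f = 1#
  Πᶠ (suc n) f = f zero * Πᶠ n (f ∘ suc)

  Πᶠ-∈ : ∀ (I : Ideal) n {f : Fin n → Elt} m → f m ∈ I → Πᶠ n f ∈ I
  Πᶠ-∈ I (suc n) {f} zero    fm∈I = ∈-resp I (*-comm _ _) (*∈ I (Πᶠ n (f ∘ suc)) fm∈I)
  Πᶠ-∈ I (suc n) {f} (suc m) fm∈I = *∈ I (f zero) (Πᶠ-∈ I n m fm∈I)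

  Πᶠ-≡1 : ∀ Q n {f : Fin n → Elt} → (∀ j → f j ≡ 1# mod Q) → Πᶠ n f ≡ 1# mod Q
  Πᶠ-≡1 Q zero    f≡1 = Mod.refl Q
  Πᶠ-≡1 Q (suc n) f≡1 =
    Mod.trans Q (Mod.*-cong Q (f≡1 zero) (Πᶠ-≡1 Q n (f≡1 ∘ suc))) (Mod.*-identityˡ Q 1#)

  _+ᴵ_ : Ideal → Ideal → Ideal
  I +ᴵ J = record
    { _∈I = λ x → Σ Elt λ y → Σ Elt λ z → y ∈ I × z ∈ J × x ≈ y + z
    ; ∈-resp = λ { x≈x′ (y , z , y∈I , z∈J , x≈y+z) → y , z , y∈I , z∈J , trans (sym x≈x′) x≈y+z }
    ; 0∈ = 0# , 0# , 0∈ I , 0∈ J , sym (+-identityʳ 0#)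
    ; +∈ = λ { (y , z , y∈I , z∈J , x≈y+z) (y′ , z′ , y′∈I , z′∈J , x′≈y′+z′) →
               y + y′ , z + z′ , +∈ I y∈I y′∈I , +∈ J z∈J z′∈J ,
               trans (+-cong x≈y+z x′≈y′+z′)
                 (solve 4 (λ y z y′ z′ → (y :+ z) :+ (y′ :+ z′) := (y :+ y′) :+ (z :+ z′))
                    refl y z y′ z′) }
    ; *∈ = λ { r (y , z , y∈I , z∈J , x≈y+z) →
               r * y , r * z , *∈ I r y∈I , *∈ J r z∈J , trans (*-congˡ x≈y+z) (distribˡ r y z) }
    }

  +ᴵ-upperˡ : ∀ {I J} → I ⊆ (I +ᴵ J)
  +ᴵ-upperˡ {I} {J} {x} x∈I = x , 0# , x∈I , 0∈ J , sym (+-identityʳ x)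

  +ᴵ-upperʳ : ∀ {I J} → J ⊆ (I +ᴵ J)
  +ᴵ-upperʳ {I} {J} {x} x∈J = 0# , x , 0∈ I , x∈J , sym (+-identityˡ x)

  ⟨_⟩ : Elt → Ideal
  ⟨ a ⟩ = record
    { _∈I = λ x → Σ Elt λ r → x ≈ r * a
    ; ∈-resp = λ { x≈x′ (r , x≈ra) → r , trans (sym x≈x′) x≈ra }
    ; 0∈ = 0# , sym (zeroˡ a)
    ; +∈ = λ { (r , x≈ra) (r′ , x′≈r′a) →
               r + r′ , trans (+-cong x≈ra x′≈r′a) (sym (distribʳ a r r′)) }
    ; *∈ = λ { s (r , x≈ra) → s * r , trans (*-congˡ x≈ra) (sym (*-assoc s r a)) }
    }

  a∈⟨a⟩ : ∀ a → a ∈ ⟨ a ⟩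
  a∈⟨a⟩ a = 1# , sym (*-identityˡ a)

  data Comaximal (I J : Ideal) : Set (c ⊔ ℓ) where
    comaximal : ∀ {x y} → x ∈ I → y ∈ J → 1# ≈ x + y → Comaximal I J

  1∈+ᴵ⇒comaximal : ∀ {I J} → 1# ∈ (I +ᴵ J) → Comaximal I J
  1∈+ᴵ⇒comaximal (_ , _ , x∈I , y∈J , 1≈x+y) = comaximal x∈I y∈J 1≈x+y

  comaximal-sym : ∀ {I J} → Comaximal I J → Comaximal J I
  comaximal-sym (comaximal {x} {y} x∈I y∈J 1≈x+y) = comaximal y∈J x∈I (trans 1≈x+y (+-comm x y))

  1≈x+y⇒1≈xⁿ+gy : ∀ {x y} n → 1# ≈ x + y → Σ Elt λ g → 1# ≈ pow x n + g * y
  1≈x+y⇒1≈xⁿ+gy {x} {y} zero    1≈x+y = 0# , sym (trans (+-congˡ (zeroˡ y)) (+-identityʳ 1#))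
  1≈x+y⇒1≈xⁿ+gy {x} {y} (suc n) 1≈x+y with 1≈x+y⇒1≈xⁿ+gy n 1≈x+y
  ... | g , 1≈xⁿ+gy = x * g + 1# , (begin
    1#                             ≈⟨ 1≈x+y ⟩
    x + y                          ≈⟨ +-congʳ (*-identityʳ x) ⟨
    x * 1# + y                     ≈⟨ +-congʳ (*-congˡ 1≈xⁿ+gy) ⟩
    x * (pow x n + g * y) + y      ≈⟨ solve 4 (λ x p g y → x :* (p :+ g :* y) :+ y
                                                        := x :* p :+ (x :* g :+ con 1) :* y)
                                               refl x (pow x n) g y ⟩
    x * pow x n + (x * g + 1#) * y ∎)
    where open import Relation.Binary.Reasoning.Setoid setoid

  comaximal-radicalˡ : ∀ {I J Q} → Comaximal I J → (∀ {x} → x ∈ I → x ∈rad Q) → Comaximal Q J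
  comaximal-radicalˡ {J = J} (comaximal {x} {y} x∈I y∈J 1≈x+y) I⊆radQ with I⊆radQ x∈I
  ... | n , xⁿ∈Q with 1≈x+y⇒1≈xⁿ+gy n 1≈x+y
  ... | g , 1≈xⁿ+gy = comaximal xⁿ∈Q (*∈ J g y∈J) 1≈xⁿ+gy

  comaximal-radical : ∀ {I J Q P} → Comaximal I J →
                      (∀ {x} → x ∈ I → x ∈rad Q) → (∀ {x} → x ∈ J → x ∈rad P) → Comaximal Q P
  comaximal-radical {Q = Q} {P} I+J I⊆radQ J⊆radP =
    comaximal-sym (comaximal-radicalˡ {Q = P}
      (comaximal-sym (comaximal-radicalˡ {Q = Q} I+J I⊆radQ)) J⊆radP)

  distinct-maximal⇒comaximal : ∀ {M N} → IsMaximal M → IsMaximal N → ¬ (M ≐ N) → Comaximal M N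
  distinct-maximal⇒comaximal {M} {N} (1∉M , maxM) (_ , maxN) M≉N
    with maxM (M +ᴵ N) (+ᴵ-upperˡ {M} {N})
  ... | inj₂ 1∈M+N = 1∈+ᴵ⇒comaximal 1∈M+N
  ... | inj₁ M+N⊆M = ⊥-elim ([ (λ (M⊆N : M ⊆ N) → M≉N (M⊆N , N⊆M)) , 1∉M ] (maxN M N⊆M))
    where
    N⊆M : N ⊆ M
    N⊆M y∈N = M+N⊆M (+ᴵ-upperʳ {M} {N} y∈N)

  maximal-dichotomy : ∀ {M} → IsMaximal M → ∀ x → x ∈ M ⊎ Comaximal M ⟨ x ⟩
  maximal-dichotomy {M} (_ , maxM) x with maxM (M +ᴵ ⟨ x ⟩) (+ᴵ-upperˡ {M} {⟨ x ⟩})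
  ... | inj₁ M+⟨x⟩⊆M = inj₁ (M+⟨x⟩⊆M (+ᴵ-upperʳ {M} {⟨ x ⟩} (a∈⟨a⟩ x)))
  ... | inj₂ 1∈M+⟨x⟩ = inj₂ (1∈+ᴵ⇒comaximal 1∈M+⟨x⟩)

  radical-comaximal⇒invertible : ∀ {M Q y} → (∀ {x} → x ∈ M → x ∈rad Q) → Comaximal M ⟨ y ⟩ →
                                 Σ Elt λ r → r * y ≡ 1# mod Q
  radical-comaximal⇒invertible {Q = Q} M⊆radQ M+⟨y⟩
    with comaximal-radicalˡ {Q = Q} M+⟨y⟩ M⊆radQ
  ... | comaximal {q} {z} q∈Q (r , z≈ry) 1≈q+z =
    r , Mod.trans Q (≈⇒≡mod Q (sym z≈ry))
          (Mod.sym Q (≈+∈⇒≡mod Q (trans 1≈q+z (+-comm q z)) q∈Q))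

  PairwiseComaximal : ∀ {k} → (Fin k → Ideal) → Set (c ⊔ ℓ)
  PairwiseComaximal {k} Q = ∀ i j → i ≢ j → Comaximal (Q i) (Q j)

  HeadUnital : Ideal → (n : ℕ) → (Fin (suc n) → Elt) → Set (c ⊔ ℓ)
  HeadUnital Q n β = Σ (Fin n → Elt) λ t → β zero + Σᶠ n (λ j → t j * β (suc j)) ≡ 1# mod Q

  headUnital-resp : ∀ Q n {β γ : Fin (suc n) → Elt} → (∀ p → β p ≡ γ p mod Q) →
                    HeadUnital Q n β → HeadUnital Q n γ
  headUnital-resp Q n {β} {γ} β≡γ (t , β-unit) = t , Mod.trans Q γ≡β β-unit
    where
    γ≡β : γ zero + Σᶠ n (λ j → t j * γ (suc j)) ≡ β zero + Σᶠ n (λ j → t j * β (suc j)) mod Q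
    γ≡β = Mod.+-cong Q (Mod.sym Q (β≡γ zero))
            (Σᶠ-cong-mod Q n (λ j → Mod.*-congˡ Q (Mod.sym Q (β≡γ (suc j)))))

  head-inverse⇒headUnital : ∀ Q n {b : Fin (suc n) → Elt} {r} → r * b zero ≡ 1# mod Q →
                            HeadUnital Q n (λ p → r * b p)
  head-inverse⇒headUnital Q n {b} {r} rb₀≡1 = (λ _ → 0#) , (begin
    r * b zero + Σᶠ n (λ j → 0# * (r * b (suc j)))  ≈⟨ ≈⇒≡mod Q (+-congˡ Σ0≈0) ⟩
    r * b zero + 0#                                ≈⟨ Mod.+-identityʳ Q _ ⟩
    r * b zero                                     ≈⟨ rb₀≡1 ⟩
    1#                                             ∎)
    where
    open import Relation.Binary.Reasoning.Setoid (Mod.setoid Q)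
    Σ0≈0 : Σᶠ n (λ j → 0# * (r * b (suc j))) ≈ 0#
    Σ0≈0 = trans (sym (*-distribˡ-Σᶠ n 0# _)) (zeroˡ _)

  head∈M⇒headUnital : ∀ {Q M} n {b : Fin (suc n) → Elt} → (∀ {x} → x ∈ M → x ∈rad Q) →
                      Unital (suc n) b → b zero ∈ M → HeadUnital Q n b
  head∈M⇒headUnital {Q} {M} n {b} M⊆radQ (c , Σcb≈1) b₀∈M
    with radical-comaximal⇒invertible {M} {Q} M⊆radQ
           (comaximal (*∈ M (c zero) b₀∈M) (a∈⟨a⟩ (Σᶠ n (λ j → c (suc j) * b (suc j))))
                      (sym Σcb≈1))
  ... | r , rΣ′≡1 = (λ j → w * c (suc j)) , (begin
    b zero + Σᶠ n (λ j → (w * c (suc j)) * b (suc j))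
      ≈⟨ Mod.+-congˡ Q (Σᶠ-cong-mod Q n (λ j → ≈⇒≡mod Q (*-assoc w _ _))) ⟩
    b zero + Σᶠ n (λ j → w * (c (suc j) * b (suc j)))
      ≈⟨ ≈⇒≡mod Q (+-congˡ (sym (*-distribˡ-Σᶠ n w _))) ⟩
    b zero + w * Σ′                                  ≈⟨ ≈⇒≡mod Q (+-congˡ (*-assoc _ r Σ′)) ⟩
    b zero + (1# + - b zero) * (r * Σ′)              ≈⟨ Mod.+-congˡ Q (Mod.*-congˡ Q rΣ′≡1) ⟩
    b zero + (1# + - b zero) * 1#                    ≈⟨ ≈⇒≡mod Q b₀+[1-b₀]≈1 ⟩
    1#                                               ∎)
    where
    open import Relation.Binary.Reasoning.Setoid (Mod.setoid Q)
    Σ′ w : Elt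
    Σ′ = Σᶠ n (λ j → c (suc j) * b (suc j))
    w = (1# + - b zero) * r
    b₀+[1-b₀]≈1 : b zero + (1# + - b zero) * 1# ≈ 1#
    b₀+[1-b₀]≈1 =
      trans (+-comm _ _) (trans (+-congʳ (*-identityʳ _)) (//-rightDividesˡ (b zero) 1#))

  unital⇒scaled-headUnital : ∀ {Q M} n {b : Fin (suc n) → Elt} → IsMaximal M → RadEq Q M →
                             Unital (suc n) b → Σ Elt λ s → HeadUnital Q n (λ p → s * b p)
  unital⇒scaled-headUnital {Q} {M} n {b} maxM (_ , M⊆radQ) b-unital
    with maximal-dichotomy {M} maxM (b zero)
  ... | inj₁ b₀∈M = 1# , headUnital-resp Q n (λ p → Mod.sym Q (Mod.*-identityˡ Q (b p)))
                           (head∈M⇒headUnital {Q} {M} n {b} M⊆radQ b-unital b₀∈M)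
  ... | inj₂ M+⟨b₀⟩ =
    let r , rb₀≡1 = radical-comaximal⇒invertible {M} {Q} M⊆radQ M+⟨b₀⟩
    in  r , head-inverse⇒headUnital Q n {b} rb₀≡1

  module _ {k} {Q : Fin k → Ideal} (comax : PairwiseComaximal Q) where

    separator : ∀ i m → Σ Elt λ y → y ≡ 1# mod Q i × (m ≢ i → y ∈ Q m)
    separator i m with m ≟ i
    ... | yes m≡i = 1# , Mod.refl (Q i) , λ m≢i → ⊥-elim (m≢i m≡i)
    ... | no m≢i with comax i m (m≢i ∘ ≡.sym)
    ...   | comaximal {x} {y} x∈Qi y∈Qm 1≈x+y =
      y , Mod.sym (Q i) (≈+∈⇒≡mod (Q i) (trans 1≈x+y (+-comm x y)) x∈Qi) , λ _ → y∈Qm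

    crtBasis : ∀ i → Σ Elt λ e → e ≡ 1# mod Q i × (∀ m → m ≢ i → e ∈ Q m)
    crtBasis i =
      Πᶠ k (proj₁ ∘ separator i) ,
      Πᶠ-≡1 (Q i) k (proj₁ ∘ proj₂ ∘ separator i) ,
      λ m m≢i → Πᶠ-∈ (Q m) k m (proj₂ (proj₂ (separator i m)) m≢i)

    chineseRemainder : (z : Fin k → Elt) → Σ Elt λ a → ∀ m → a ≡ z m mod Q m
    chineseRemainder z = Σᶠ k (λ i → e i * z i) , Σez≡z
      where
      e : Fin k → Elt
      e i = proj₁ (crtBasis i)
      e≡1 : ∀ i → e i ≡ 1# mod Q i
      e≡1 i = proj₁ (proj₂ (crtBasis i))
      ez∈Q : ∀ i m → m ≢ i → (e i * z i) ∈ Q m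
      ez∈Q i m m≢i =
        ∈-resp (Q m) (*-comm _ _) (*∈ (Q m) (z i) (proj₂ (proj₂ (crtBasis i)) m m≢i))
      Σez≡z : ∀ m → Σᶠ k (λ i → e i * z i) ≡ z m mod Q m
      Σez≡z m = begin
        Σᶠ k (λ i → e i * z i)  ≈⟨ Σᶠ-≡-single (Q m) _ m (λ i i≢m → ez∈Q i m (i≢m ∘ ≡.sym)) ⟩
        e m * z m               ≈⟨ Mod.*-congʳ (Q m) (e≡1 m) ⟩
        1# * z m                ≈⟨ Mod.*-identityˡ (Q m) (z m) ⟩
        z m                     ∎
        where open import Relation.Binary.Reasoning.Setoid (Mod.setoid (Q m))

    headUnital-lift : ∀ n (B : Fin k → Fin (suc n) → Elt) → (∀ i → HeadUnital (Q i) n (B i)) →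
                      Σ (Fin (suc n) → Elt) λ a → Unital (suc n) a × (∀ i p → a p ≡ B i p mod Q i)
    headUnital-lift n B headUnital = a , (coefficient , a-unital) , a≡B
      where
      t : Fin k → Fin n → Elt
      t i = proj₁ (headUnital i)
      x : Fin n → Elt
      x j = proj₁ (chineseRemainder (λ i → t i j))
      a′ : Fin n → Elt
      a′ j = proj₁ (chineseRemainder (λ i → B i (suc j)))
      S : Elt
      S = Σᶠ n (λ j → x j * a′ j)
      a : Fin (suc n) → Elt
      a zero    = 1# + - S
      a (suc j) = a′ j
      coefficient : Fin (suc n) → Elt
      coefficient zero    = 1#
      coefficient (suc j) = x j
      a-unital : 1# * (1# + - S) + S ≈ 1#
      a-unital = trans (+-congʳ (*-identityˡ _)) (//-rightDividesˡ S 1#)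
      a≡B : ∀ i p → a p ≡ B i p mod Q i
      a≡B i (suc j) = proj₂ (chineseRemainder (λ i → B i (suc j))) i
      a≡B i zero    = begin
        1# + - S
          ≈⟨ Mod.+-cong (Q i) (Mod.sym (Q i) (proj₂ (headUnital i))) (Mod.-‿cong (Q i) S≡T) ⟩
        (B i zero + T) + - T  ≈⟨ ≈⇒≡mod (Q i) (//-rightDividesʳ T (B i zero)) ⟩
        B i zero              ∎
        where
        open import Relation.Binary.Reasoning.Setoid (Mod.setoid (Q i))
        T : Elt
        T = Σᶠ n (λ j → t i j * B i (suc j))
        S≡T : S ≡ T mod Q i
        S≡T = Σᶠ-cong-mod (Q i) n (λ j → Mod.*-cong (Q i)
          (proj₂ (chineseRemainder (λ i → t i j)) i) (proj₂ (chineseRemainder (λ i → B i (suc j))) i))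

  ≡-multiple⇒ProjEquiv : ∀ Q {n} s {a b : Fin n → Elt} → (∀ p → a p ≡ s * b p mod Q) →
                         ProjEquiv Q n a b
  ≡-multiple⇒ProjEquiv Q s {a} {b} a≡sb i j _ = begin
    a i * b j        ≈⟨ Mod.*-congʳ Q (a≡sb i) ⟩
    (s * b i) * b j  ≈⟨ ≈⇒≡mod Q (solve 3 (λ s x y → (s :* x) :* y := (s :* y) :* x)
                                          refl s (b i) (b j)) ⟩
    (s * b j) * b i  ≈⟨ Mod.*-congʳ Q (a≡sb j) ⟨
    a j * b i        ∎
    where open import Relation.Binary.Reasoning.Setoid (Mod.setoid Q)

  reduction-surjective : ∀ {k} n (Q M : Fin k → Ideal) →
    (∀ i → IsMaximal (M i)) → (∀ i j → i ≢ j → ¬ (M i ≐ M j)) → (∀ i → RadEq (Q i) (M i)) →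
    (b : Fin k → Fin (suc n) → Elt) → (∀ i → Unital (suc n) (b i)) →
    Σ (Fin (suc n) → Elt) λ a → Unital (suc n) a × (∀ i → ProjEquiv (Q i) (suc n) a (b i))
  reduction-surjective {k} n Q M maximal distinct radical b unital =
    let a , a-unital , a≡sb = headUnital-lift comax n (λ i p → s i * b i p) (proj₂ ∘ scaled)
    in  a , a-unital , λ i → ≡-multiple⇒ProjEquiv (Q i) (s i) (a≡sb i)
    where
    comax : PairwiseComaximal Q
    comax i j i≢j = comaximal-radical {Q = Q i} {Q j}
      (distinct-maximal⇒comaximal {M i} {M j} (maximal i) (maximal j) (distinct i j i≢j))
      (proj₂ (radical i)) (proj₂ (radical j))
    scaled : ∀ i → Σ Elt λ s → HeadUnital (Q i) n (λ p → s * b i p)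
    scaled i = unital⇒scaled-headUnital {Q i} {M i} n {b i} (maximal i) (radical i) (unital i)
    s : Fin k → Elt
    s i = proj₁ (scaled i)

mainTheorem1 : ∀ {c ℓ : Level} (R : CommutativeRing c ℓ) → let open RingDefs R in
  (l k : ℕ) (Q M : Fin k → Ideal) →
  (∀ i → NonZero (Q i)) →
  (∀ i → IsMaximal (M i)) →
  (∀ i j → ¬ (i ≡ j) → ¬ (M i ≐ M j)) →
  (∀ i → RadEq (Q i) (M i)) →
  NonZero (prodIdeals k Q) →
  (b : Fin k → Fin (suc (suc l)) → Elt) →
  (∀ i → Unital (suc (suc l)) (b i)) →
  Σ (Fin (suc (suc l)) → Elt) λ a →
    Unital (suc (suc l)) a × (∀ i → ProjEquiv (Q i) (suc (suc l)) a (b i))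
-- The nonzero hypotheses only place the ideals in INTRAD(R)*; the argument never needs them.
mainTheorem1 R l k Q M _ maximal distinct radical _ =
  reduction-surjective R (suc l) Q M maximal distinct radical
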